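{- Let $X$ be a circuit-hyperplane of a matroid $M$, and let $M'$ be the matroid obtained from $M$ by relaxing $X$. If $\mathcal{N}$ is a set of matroids such that $M'$ has an $\mathcal{N}$-minor but $M$ has no $\mathcal{N}$-minor, then $M'$ is $\mathcal{N}$-fragile. Moreover, $X$ is a basis of $M'$ whose elements are nondeletable, and the elements of the cobasis $E(M')-X$ are noncontractible.
   Context: Relaxing a circuit-hyperplane $X$ of $M$ gives the matroid $M'$ on the same ground set with bases $\mathcal{B}(M)\cup\{X\}$. A matroid has an $\mathcal{N}$-minor if it has a minor isomorphic to a member of $\mathcal{N}$. $M$ is $\mathcal{N}$-fragile if it has an $\mathcal{N}$-minor and, for each element $e$, at most one of $M\backslash e$, $M/e$ has an $\mathcal{N}$-minor. An element $e$ is nondeletable if $M\backslash e$ has no $\mathcal{N}$-minor and noncontractible if $M/e$ has no $\mathcal{N}$-minor. -}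

module Defs where

open import Data.Nat using (ℕ; zero; suc; _<_; _≤_; _∸_)
open import Data.Bool using (Bool; true; false)
open import Data.Fin using (Fin)
open import Data.Fin.Subset using (Subset; ⁅_⁆; _∈_; _∉_; _⊆_; _⊂_; _∪_; _─_; ∣_∣; ⊤) renaming (⊥ to ∅)
open import Data.Vec using (insertAt; tabulate; lookup)
open import Data.Product using (Σ; ∃; _×_; _,_)
open import Data.Sum using (_⊎_)
open import Relation.Nullary using (¬_)
open import Relation.Binary.PropositionalEquality using (_≡_)
open import Function.Bundles using (_⇔_; _↔_; Inverse)

IndPred : ℕ → Set₁
IndPred n = Subset n → Set

record Matroid (n : ℕ) : Set₁ where
  field
    Indep      : Subset n → Set
    indep-∅    : Indep ∅
    indep-⊆    : ∀ {I J} → Indep J → I ⊆ J → Indep I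
    indep-aug  : ∀ {I J} → Indep I → Indep J → ∣ I ∣ < ∣ J ∣ →
                 ∃ λ e → e ∈ J × e ∉ I × Indep (I ∪ ⁅ e ⁆)
open Matroid public

module _ {n : ℕ} (M : Matroid n) where
  IsBase : Subset n → Set
  IsBase B = Indep M B × (∀ J → Indep M J → B ⊆ J → J ≡ B)

  IsCircuit : Subset n → Set
  IsCircuit C = ¬ Indep M C × (∀ D → D ⊂ C → Indep M D)

  HasRank : Subset n → ℕ → Set
  HasRank X r = (∃ λ I → I ⊆ X × Indep M I × ∣ I ∣ ≡ r)
              × (∀ J → J ⊆ X → Indep M J → ∣ J ∣ ≤ r)

  IsFlat : Subset n → Set
  IsFlat X = ∀ e → e ∉ X → ∀ r → HasRank X r → ¬ HasRank (X ∪ ⁅ e ⁆) r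

  IsHyperplane : Subset n → Set
  IsHyperplane X = IsFlat X × (∃ λ r → HasRank X r × HasRank ⊤ (suc r))

  IsCircuitHyperplane : Subset n → Set
  IsCircuitHyperplane X = IsCircuit X × IsHyperplane X

IsRelaxation : ∀ {n} → Matroid n → Subset n → Matroid n → Set
IsRelaxation M X M' = ∀ B → IsBase M' B ⇔ (IsBase M B ⊎ B ≡ X)

-- Single-element deletion / contraction on independence predicates.
-- The ground set Fin (suc n) minus e is identified with Fin n via insertAt
-- (i.e. punchIn e).
del : ∀ {n} → IndPred (suc n) → Fin (suc n) → IndPred n
del P e I = P (insertAt I e false)

-- M/e : if e is a loop, M/e = M\e; otherwise I is independent in M/e
-- iff I ∪ {e} is independent in M.
con : ∀ {n} → IndPred (suc n) → Fin (suc n) → IndPred n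
con P e I = (¬ P ⁅ e ⁆ × P (insertAt I e false))
          ⊎ (P ⁅ e ⁆ × P (insertAt I e true))

-- image of a subset of Fin k along a bijection, given by its inverse g
rename : ∀ {k n} → (Fin n → Fin k) → Subset k → Subset n
rename g I = tabulate (λ j → lookup I (g j))

data Minor : ∀ {k n} → IndPred k → IndPred n → Set₁ where
  iso     : ∀ {k n} {Q : IndPred k} {P : IndPred n} (σ : Fin k ↔ Fin n) →
            (∀ I → Q I ⇔ P (rename (Inverse.from σ) I)) → Minor Q P
  del-step : ∀ {k n} {Q : IndPred k} {P : IndPred (suc n)} (e : Fin (suc n)) →
            Minor Q (del P e) → Minor Q P
  con-step : ∀ {k n} {Q : IndPred k} {P : IndPred (suc n)} (e : Fin (suc n)) →
            Minor Q (con P e) → Minor Q P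

MatroidClass : Set₁
MatroidClass = ∀ {k} → Matroid k → Set

HasNMinor : ∀ {n} → MatroidClass → IndPred n → Set₁
HasNMinor 𝒩 P = Σ ℕ λ k → Σ (Matroid k) λ N → 𝒩 N × Minor (Indep N) P

DelHasNMinor : ∀ {n} → MatroidClass → Matroid n → Fin n → Set₁
DelHasNMinor {suc n} 𝒩 M e = HasNMinor 𝒩 (del (Indep M) e)

ConHasNMinor : ∀ {n} → MatroidClass → Matroid n → Fin n → Set₁
ConHasNMinor {suc n} 𝒩 M e = HasNMinor 𝒩 (con (Indep M) e)

Nondeletable : ∀ {n} → MatroidClass → Matroid n → Fin n → Set₁
Nondeletable 𝒩 M e = ¬ DelHasNMinor 𝒩 M e

Noncontractible : ∀ {n} → MatroidClass → Matroid n → Fin n → Set₁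
Noncontractible 𝒩 M e = ¬ ConHasNMinor 𝒩 M e

Fragile : ∀ {n} → MatroidClass → Matroid n → Set₁
Fragile 𝒩 M = HasNMinor 𝒩 (Indep M)
            × (∀ e → ¬ (DelHasNMinor 𝒩 M e × ConHasNMinor 𝒩 M e))

module Submission where

-- M and M' have the same independent sets except X, which is independent only in M'.
-- For e ∈ X, no independent set of M\e or M'\e contains X, so M'\e = M\e and an
-- 𝒩-minor of M'\e would be one of M.  For e ∉ X, e is not a loop since X is a
-- hyperplane, so the independent sets of M/e and M'/e are the I with I ∪ e independent;
-- none of these is X, so again M'/e = M/e.  Thus no element is both deletable and
-- contractible.

open import Defs
open import Data.Nat using (ℕ; zero; suc; _+_; _≤_; _<_)
open import Data.Nat.Properties using (<⇒≱; ≮⇒≥; +-suc; ≤-trans; ≤-reflexive; +-monoʳ-≤; m≤m+n; _<?_)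
open import Data.Fin using (Fin)
open import Data.Fin.Subset using (Subset; _∈_; _∉_; _⊆_; _∪_; ⁅_⁆; ∣_∣; ⊤)
open import Data.Fin.Subset.Properties
  using (_∈?_; ∈⊤; ⊆-antisym; p⊂q⇒∣p∣<∣q∣; p⊆p∪q; x∈p∪q⁺; x∈p∪q⁻; x∈⁅x⁆; x∈⁅y⁆⇒x≡y)
open import Data.Vec using (insertAt)
open import Data.Vec.Properties using (insertAt-lookup; []=⇒lookup; lookup⇒[]=)
open import Data.Bool using (true; false)
open import Data.Product using (_×_; _,_; proj₁; proj₂; ∃)
open import Data.Product.Function.NonDependent.Propositional using (_×-⇔_)
open import Data.Sum using (inj₁; inj₂; [_,_])
open import Data.Sum.Function.Propositional using (_⊎-⇔_)
open import Data.Empty using (⊥-elim)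
open import Function using (_∘_)
open import Function.Bundles using (_⇔_; mk⇔; Equivalence)
open import Function.Properties.Equivalence using () renaming (sym to ⇔-sym; trans to ⇔-trans)
open import Function.Related.TypeIsomorphisms using (¬-cong-⇔)
open import Relation.Nullary using (¬_; yes; no)
open import Relation.Nullary.Negation using (¬¬-map)
open import Relation.Binary.PropositionalEquality using (_≡_; refl; sym; trans; subst)

module _ {n : ℕ} where

  p⊆q∧∣q∣≤∣p∣⇒q≡p : {p q : Subset n} → p ⊆ q → ∣ q ∣ ≤ ∣ p ∣ → q ≡ p
  p⊆q∧∣q∣≤∣p∣⇒q≡p {p} {q} p⊆q ∣q∣≤∣p∣ = ⊆-antisym q⊆p p⊆q
    where
    q⊆p : q ⊆ p
    q⊆p {x} x∈q with x ∈? p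
    ... | yes x∈p = x∈p
    ... | no x∉p = ⊥-elim (<⇒≱ (p⊂q⇒∣p∣<∣q∣ (p⊆q , x , x∈q , x∉p)) ∣q∣≤∣p∣)

  x∈p∪⁅x⁆ : (p : Subset n) (x : Fin n) → x ∈ p ∪ ⁅ x ⁆
  x∈p∪⁅x⁆ p x = x∈p∪q⁺ (inj₂ (x∈⁅x⁆ x))

  x∉p⇒∣p∣<∣p∪⁅x⁆∣ : {p : Subset n} {x : Fin n} → x ∉ p → ∣ p ∣ < ∣ p ∪ ⁅ x ⁆ ∣
  x∉p⇒∣p∣<∣p∪⁅x⁆∣ {p} {x} x∉p = p⊂q⇒∣p∣<∣q∣ (p⊆p∪q ⁅ x ⁆ , x , x∈p∪⁅x⁆ p x , x∉p)

  m≤1+k+∣p∣⇒m≤k+∣p∪⁅x⁆∣ : ∀ {m} k {p : Subset n} {x : Fin n} →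
                           x ∉ p → m ≤ suc k + ∣ p ∣ → m ≤ k + ∣ p ∪ ⁅ x ⁆ ∣
  m≤1+k+∣p∣⇒m≤k+∣p∪⁅x⁆∣ k {p} x∉p m≤ =
    ≤-trans m≤ (≤-trans (≤-reflexive (sym (+-suc k ∣ p ∣))) (+-monoʳ-≤ k (x∉p⇒∣p∣<∣p∪⁅x⁆∣ x∉p)))

  x∈p⇒⁅x⁆⊆p : {p : Subset n} {x : Fin n} → x ∈ p → ⁅ x ⁆ ⊆ p
  x∈p⇒⁅x⁆⊆p {p} {x} x∈p y∈⁅x⁆ = subst (_∈ p) (sym (x∈⁅y⁆⇒x≡y x y∈⁅x⁆)) x∈p

i∉insertAt-false : ∀ {n} (p : Subset n) (i : Fin (suc n)) → i ∉ insertAt p i false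
i∉insertAt-false p i i∈ with () ← trans (sym (insertAt-lookup p i false)) ([]=⇒lookup i∈)

i∈insertAt-true : ∀ {n} (p : Subset n) (i : Fin (suc n)) → i ∈ insertAt p i true
i∈insertAt-true p i = lookup⇒[]= i _ (insertAt-lookup p i true)

module _ {n : ℕ} (M : Matroid n) where

  IsLargestIndep : Subset n → Set
  IsLargestIndep B = Indep M B × (∀ J → Indep M J → ∣ J ∣ ≤ ∣ B ∣)

  IsLoop : Fin n → Set
  IsLoop e = ¬ Indep M ⁅ e ⁆

  base⇒largest : ∀ {B} → IsBase M B → IsLargestIndep B
  base⇒largest {B} (iB , maximal) = iB , λ J iJ → ≮⇒≥ λ ∣B∣<∣J∣ →
    let (e , _ , e∉B , iB+e) = indep-aug M iB iJ ∣B∣<∣J∣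
    in e∉B (subst (e ∈_) (maximal _ iB+e (p⊆p∪q ⁅ e ⁆)) (x∈p∪⁅x⁆ B e))

  rank⊤⇒largest : ∀ {r} → HasRank M ⊤ r → ∃ IsLargestIndep
  rank⊤⇒largest ((B , _ , iB , ∣B∣≡r) , bound) =
    B , iB , λ J iJ → subst (∣ J ∣ ≤_) (sym ∣B∣≡r) (bound J (λ _ → ∈⊤) iJ)

  module _ {B : Subset n} (largest : IsLargestIndep B) where

    largest-size⇒base : ∀ {S} → Indep M S → ∣ B ∣ ≤ ∣ S ∣ → IsBase M S
    largest-size⇒base iS ∣B∣≤∣S∣ =
      iS , λ J iJ S⊆J → p⊆q∧∣q∣≤∣p∣⇒q≡p S⊆J (≤-trans (proj₂ largest J iJ) ∣B∣≤∣S∣)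

    -- Augment S by elements of B until it is as large as B; k is fuel for the recursion.
    extend-to-base : ∀ k {S} → Indep M S → ∣ B ∣ ≤ k + ∣ S ∣ → ∃ λ T → S ⊆ T × IsBase M T
    extend-to-base k {S} iS fuel with ∣ S ∣ <? ∣ B ∣
    ... | no ∣S∣≮∣B∣ = S , (λ x∈S → x∈S) , largest-size⇒base iS (≮⇒≥ ∣S∣≮∣B∣)
    extend-to-base zero iS fuel | yes ∣S∣<∣B∣ = ⊥-elim (<⇒≱ ∣S∣<∣B∣ fuel)
    extend-to-base (suc k) iS fuel | yes ∣S∣<∣B∣ =
      let (e , _ , e∉S , iS+e) = indep-aug M iS (proj₁ largest) ∣S∣<∣B∣
          (T , S+e⊆T , bT) = extend-to-base k iS+e (m≤1+k+∣p∣⇒m≤k+∣p∪⁅x⁆∣ k e∉S fuel)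
      in T , S+e⊆T ∘ p⊆p∪q ⁅ e ⁆ , bT

    indep⇒⊆base : ∀ {S} → Indep M S → ∃ λ T → S ⊆ T × IsBase M T
    indep⇒⊆base {S} iS = extend-to-base ∣ B ∣ iS (m≤m+n ∣ B ∣ ∣ S ∣)

  loop⇒rank-∪ : ∀ {X e r} → IsLoop e → HasRank M X r → HasRank M (X ∪ ⁅ e ⁆) r
  loop⇒rank-∪ {X} {e} loop ((I , I⊆X , iI , ∣I∣≡r) , bound) =
    (I , p⊆p∪q ⁅ e ⁆ ∘ I⊆X , iI , ∣I∣≡r) , λ J J⊆X+e iJ → bound J (indep⊆X J⊆X+e iJ) iJ
    where
    indep⊆X : ∀ {J} → J ⊆ X ∪ ⁅ e ⁆ → Indep M J → J ⊆ X
    indep⊆X J⊆X+e iJ x∈J with x∈p∪q⁻ X ⁅ e ⁆ (J⊆X+e x∈J)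
    ... | inj₁ x∈X = x∈X
    ... | inj₂ x∈⁅e⁆ with refl ← x∈⁅y⁆⇒x≡y e x∈⁅e⁆ = ⊥-elim (loop (indep-⊆ M iJ (x∈p⇒⁅x⁆⊆p x∈J)))

  ∉flat⇒¬loop : ∀ {X e r} → IsFlat M X → HasRank M X r → e ∉ X → ¬ IsLoop e
  ∉flat⇒¬loop flat rX e∉X loop = flat _ e∉X _ rX (loop⇒rank-∪ loop rX)

  ∉hyperplane⇒¬loop : ∀ {X e} → IsHyperplane M X → e ∉ X → ¬ IsLoop e
  ∉hyperplane⇒¬loop (flat , _ , rank-X , _) = ∉flat⇒¬loop flat rank-X

  hyperplane⇒largest : ∀ {X} → IsHyperplane M X → ∃ IsLargestIndep
  hyperplane⇒largest (_ , _ , _ , rank-⊤) = rank⊤⇒largest rank-⊤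

con-¬loop-⇔ : ∀ {n} (M : Matroid (suc n)) {e} → ¬ IsLoop M e →
              ∀ I → con (Indep M) e I ⇔ Indep M (insertAt I e true)
con-¬loop-⇔ M {e} ¬loop I =
  mk⇔ [ ⊥-elim ∘ ¬loop ∘ proj₁ , proj₂ ]
      (λ i → inj₂ (indep-⊆ M i (x∈p⇒⁅x⁆⊆p (i∈insertAt-true I e)) , i))

module _ {k : ℕ} {Q : IndPred k} where

  Minor-resp-⇔ : ∀ {n} {P P' : IndPred n} → Minor Q P → (∀ I → P I ⇔ P' I) → Minor Q P'
  Minor-resp-⇔ (iso σ Q⇔P) P⇔P' = iso σ λ I → ⇔-trans (Q⇔P I) (P⇔P' _)
  Minor-resp-⇔ (del-step e m) P⇔P' = del-step e (Minor-resp-⇔ m (λ I → P⇔P' _))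
  Minor-resp-⇔ (con-step e m) P⇔P' = con-step e (Minor-resp-⇔ m λ I →
    (¬-cong-⇔ (P⇔P' _) ×-⇔ P⇔P' _) ⊎-⇔ (P⇔P' _ ×-⇔ P⇔P' _))

module _ {𝒩 : MatroidClass} {n : ℕ} where

  HasNMinor-resp-⇔ : {P P' : IndPred n} → HasNMinor 𝒩 P → (∀ I → P I ⇔ P' I) → HasNMinor 𝒩 P'
  HasNMinor-resp-⇔ (k , N , N∈𝒩 , m) P⇔P' = k , N , N∈𝒩 , Minor-resp-⇔ m P⇔P'

  del-HasNMinor : {P : IndPred (suc n)} (e : Fin (suc n)) → HasNMinor 𝒩 (del P e) → HasNMinor 𝒩 P
  del-HasNMinor e (k , N , N∈𝒩 , m) = k , N , N∈𝒩 , del-step e m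

  con-HasNMinor : {P : IndPred (suc n)} (e : Fin (suc n)) → HasNMinor 𝒩 (con P e) → HasNMinor 𝒩 P
  con-HasNMinor e (k , N , N∈𝒩 , m) = k , N , N∈𝒩 , con-step e m

module Relaxation {n : ℕ} (M M' : Matroid n) (X : Subset n)
                  (rel : IsRelaxation M X M') (largestM : ∃ (IsLargestIndep M)) where

  X-base : IsBase M' X
  X-base = Equivalence.from (rel X) (inj₂ refl)

  indep⇒indep' : ∀ {S} → Indep M S → Indep M' S
  indep⇒indep' iS =
    let (T , S⊆T , bT) = indep⇒⊆base M (proj₂ largestM) iS
    in indep-⊆ M' (proj₁ (Equivalence.from (rel T) (inj₁ bT))) S⊆T

  indep'⇒indep : ∀ {S} → (S ⊆ X → Indep M S) → Indep M' S → Indep M S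
  indep'⇒indep subset-of-X iS with indep⇒⊆base M' (base⇒largest M' X-base) iS
  ... | T , S⊆T , bT with Equivalence.to (rel T) bT
  ...   | inj₁ bT-in-M = indep-⊆ M (proj₁ bT-in-M) S⊆T
  ...   | inj₂ refl = subset-of-X S⊆T

  indep'⇔indep : ∀ {S} → (S ⊆ X → Indep M S) → Indep M' S ⇔ Indep M S
  indep'⇔indep subset-of-X = mk⇔ (indep'⇒indep subset-of-X) indep⇒indep'

module CircuitHyperplaneRelaxation {n : ℕ} (M M' : Matroid n) (X : Subset n)
                                   (chX : IsCircuitHyperplane M X) (rel : IsRelaxation M X M') where

  open Relaxation M M' X rel (hyperplane⇒largest M (proj₂ chX)) public

  proper-subset-indep : ∀ {S} → S ⊆ X → ∀ {e} → e ∈ X → e ∉ S → Indep M S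
  proper-subset-indep S⊆X e∈X e∉S = proj₂ (proj₁ chX) _ (S⊆X , _ , e∈X , e∉S)

  ∉X⇒¬loop : ∀ {e} → e ∉ X → ¬ IsLoop M e
  ∉X⇒¬loop = ∉hyperplane⇒¬loop M (proj₂ chX)

relaxed-nondeletable : ∀ {n} (𝒩 : MatroidClass) (M M' : Matroid n) (X : Subset n) →
                       IsCircuitHyperplane M X → IsRelaxation M X M' → ¬ HasNMinor 𝒩 (Indep M) →
                       ∀ e → e ∈ X → Nondeletable 𝒩 M' e
relaxed-nondeletable {suc _} 𝒩 M M' X chX rel ¬M-minor e e∈X M'∖e-minor =
  ¬M-minor (del-HasNMinor e (HasNMinor-resp-⇔ M'∖e-minor λ I →
    indep'⇔indep λ ⊆X → proper-subset-indep ⊆X e∈X (i∉insertAt-false I e)))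
  where open CircuitHyperplaneRelaxation M M' X chX rel

relaxed-noncontractible : ∀ {n} (𝒩 : MatroidClass) (M M' : Matroid n) (X : Subset n) →
                          IsCircuitHyperplane M X → IsRelaxation M X M' → ¬ HasNMinor 𝒩 (Indep M) →
                          ∀ e → e ∉ X → Noncontractible 𝒩 M' e
relaxed-noncontractible {suc _} 𝒩 M M' X chX rel ¬M-minor e e∉X M'／e-minor =
  ¬M-minor (con-HasNMinor e (HasNMinor-resp-⇔ M'／e-minor λ I →
    ⇔-trans (con-¬loop-⇔ M' ¬loop' I)
            (⇔-trans (indep'⇔indep (λ ⊆X → ⊥-elim (e∉X (⊆X (i∈insertAt-true I e)))))
                     (⇔-sym (con-¬loop-⇔ M ¬loop I)))))
  where
  open CircuitHyperplaneRelaxation M M' X chX rel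
  ¬loop : ¬ IsLoop M e
  ¬loop = ∉X⇒¬loop e∉X
  ¬loop' : ¬ IsLoop M' e
  ¬loop' = ¬¬-map indep⇒indep' ¬loop

lemma2p3 : {n : ℕ} (𝒩 : MatroidClass) (M M' : Matroid n) (X : Subset n) →
    IsCircuitHyperplane M X → IsRelaxation M X M' →
    HasNMinor 𝒩 (Indep M') → ¬ HasNMinor 𝒩 (Indep M) →
    Fragile 𝒩 M'
      × IsBase M' X
      × (∀ e → e ∈ X → Nondeletable 𝒩 M' e)
      × (∀ e → e ∉ X → Noncontractible 𝒩 M' e)
lemma2p3 𝒩 M M' X chX rel M'-minor ¬M-minor =
  (M'-minor , fragile) , CircuitHyperplaneRelaxation.X-base M M' X chX rel , nondeletable , noncontractible
  where
  nondeletable : ∀ e → e ∈ X → Nondeletable 𝒩 M' e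
  nondeletable = relaxed-nondeletable 𝒩 M M' X chX rel ¬M-minor
  noncontractible : ∀ e → e ∉ X → Noncontractible 𝒩 M' e
  noncontractible = relaxed-noncontractible 𝒩 M M' X chX rel ¬M-minor
  fragile : ∀ e → ¬ (DelHasNMinor 𝒩 M' e × ConHasNMinor 𝒩 M' e)
  fragile e (M'∖e-minor , M'／e-minor) with e ∈? X
  ... | yes e∈X = nondeletable e e∈X M'∖e-minor
  ... | no e∉X = noncontractible e e∉X M'／e-minor
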